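{- Let $\tau$ be a middle shape such that every vertex of $\tau$ has a path (in the multigraph of $\tau$) to some vertex of $U_\tau \cup V_\tau$. Then for every vertex separator $S$ of $\tau$, \[ |E(\tau) \setminus E(S)| \ge |V(\tau) \setminus S|. \]
   Context: A shape $\tau$ consists of a finite multigraph $(V(\tau),E(\tau))$ without self-loops together with two subsets $U_\tau,V_\tau\subseteq V(\tau)$. A vertex separator of $\tau$ is a set $S\subseteq V(\tau)$ such that every path from a vertex of $U_\tau$ to a vertex of $V_\tau$ (including length-0 paths, so $U_\tau\cap V_\tau\subseteq S$) contains a vertex of $S$. A minimum vertex separator (MVS) is a vertex separator of smallest possible size. An MVS $S$ is the leftmost MVS if for every MVS $S'$, every path from $U_\tau$ to a vertex of $S'$ contains a vertex of $S$; the rightmost MVS is defined symmetrically with $V_\tau$ in place of $U_\tau$. $\tau$ is a middle shape if $U_\tau$ is the leftmost MVS of $\tau$ and $V_\tau$ is the rightmost MVS of $\tau$. $E(S)$ denotes the multiset of edges of $\tau$ with both endpoints in $S$, and edges are counted with multiplicity. -}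

module Defs where

open import Data.Nat using (ℕ; zero; suc)
open import Data.Bool using (Bool; true; false; _∧_)
open import Data.Fin using (Fin)
open import Data.Fin.Subset using (Subset; _∈_; _∪_; ∣_∣)
open import Data.Vec using (lookup)
open import Data.List using (List; []; _∷_)
open import Data.List.Relation.Unary.All using (All)
open import Data.List.Relation.Unary.Any using (Any)
open import Data.List.Membership.Propositional renaming (_∈_ to _∈ˡ_)
open import Data.Product using (_×_; _,_; ∃)
open import Data.Sum using (_⊎_)
open import Data.Nat using (_≤_)
open import Relation.Binary.PropositionalEquality using (_≢_)

-- A shape: vertex set Fin n, a multigraph given as a list of edges
-- (pairs of endpoints; repetitions = multiplicity), no self-loops,
-- and two distinguished vertex subsets U and V.
record Shape : Set where
  field
    n      : ℕ
    edges  : List (Fin n × Fin n)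
    noLoop : All (λ e → Data.Product.proj₁ e ≢ Data.Product.proj₂ e) edges
    U      : Subset n
    V      : Subset n

module _ {n : ℕ} (E : List (Fin n × Fin n)) where

  Adj : Fin n → Fin n → Set
  Adj a b = ((a , b) ∈ˡ E) ⊎ ((b , a) ∈ˡ E)

  data Path : Fin n → Fin n → Set where
    stop : (a : Fin n) → Path a a
    step : {a b c : Fin n} → Adj a b → Path b c → Path a c

  verts : {a b : Fin n} → Path a b → List (Fin n)
  verts (stop a) = a ∷ []
  verts (step {a} _ p) = a ∷ verts p

  Blocks : Subset n → Subset n → Subset n → Set
  Blocks A B S = ∀ a b → a ∈ A → b ∈ B → (p : Path a b) → Any (λ x → x ∈ S) (verts p)

  IsSeparator : Subset n → Subset n → Subset n → Set
  IsSeparator U V S = Blocks U V S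

  IsMVS : Subset n → Subset n → Subset n → Set
  IsMVS U V S = IsSeparator U V S × (∀ S' → IsSeparator U V S' → ∣ S ∣ ≤ ∣ S' ∣)

  IsLeftmostMVS : Subset n → Subset n → Subset n → Set
  IsLeftmostMVS U V S = IsMVS U V S × (∀ S' → IsMVS U V S' → Blocks U S' S)

  IsRightmostMVS : Subset n → Subset n → Subset n → Set
  IsRightmostMVS U V S = IsMVS U V S × (∀ S' → IsMVS U V S' → Blocks V S' S)

  edgesOutside : Subset n → ℕ
  edgesOutside S = go E
    where
    go : List (Fin n × Fin n) → ℕ
    go [] = zero
    go ((a , b) ∷ es) with lookup S a ∧ lookup S b
    ... | true  = go es
    ... | false = suc (go es)

IsMiddle : Shape → Set
IsMiddle τ = IsLeftmostMVS edges U V U × IsRightmostMVS edges U V V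
  where open Shape τ

AllConnectedToUV : Shape → Set
AllConnectedToUV τ = ∀ x → ∃ λ y → y ∈ (U ∪ V) × Path edges x y
  where open Shape τ

-- Grow a set T ⊇ S one vertex at a time. While some edge joins a vertex x ∉ T to T,
-- passing to T ∪ {x} shrinks ∁ T by one vertex and the edges not inside T by at
-- least that edge, so the bound |∁ T| ≤ |E \ E(T)| follows from the one for T ∪ {x}.
-- The growth can only stop at T = V(τ): if no edge leaves T, then T is a union of
-- connected components containing S, so U ∩ T and V ∩ T are again separators; by
-- minimality U ⊆ T and V ⊆ T, and every vertex is connected to U ∪ V.
module Submission where

open import Defs
open import Data.Nat using (_≤_)
open import Data.Fin.Subset using (Subset; ∁; ∣_∣)

open import Data.Bool using (Bool; true; false; _∧_; if_then_else_; b≤b; f≤t)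
  renaming (_≤_ to _≤ᵇ_)
open import Data.Bool.Properties using (≤-minimum; ¬-not; ∧-zeroʳ)
open import Data.Fin using (Fin; zero; suc)
open import Data.Fin.Subset using (_∈_; _∉_; _⊆_; _⊂_; _∩_; _∪_; ⁅_⁆)
open import Data.Fin.Subset.Properties
  using (_∈?_; ∪-identityʳ; x∈⁅x⁆; x∈p∪q⁺; x∈p∪q⁻; p⊆p∪q; x∈p∩q⁺; x∈p∩q⁻; p∩q⊆p;
         p⊂q⇒∣p∣<∣q∣; x∈∁p⇒x∉p; Empty-unique; ∣⊥∣≡0; ⊆-refl)
open import Data.List using (List; []; _∷_)
open import Data.List.Membership.Propositional using (find; lose) renaming (_∈_ to _∈ˡ_)
open import Data.List.Relation.Unary.Any as Any using (Any; here; there; any?)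
open import Data.Nat using (ℕ; zero; suc; z≤n; s≤s; _<_)
open import Data.Nat.Induction using (<-wellFounded)
open import Data.Nat.Properties using (<⇒≱; m≤n⇒m≤1+n; ≤-reflexive; module ≤-Reasoning)
open import Data.Product using (_×_; _,_; proj₂; ∃; ∃₂)
open import Data.Sum using (_⊎_; inj₁; inj₂; [_,_]; swap)
open import Data.Vec using (_∷_; lookup; _[_]=_)
open import Data.Vec.Properties using ([]=⇒lookup; lookup⇒[]=)
open import Function using (_∘_)
open import Induction.WellFounded using (Acc; acc)
open import Relation.Binary.PropositionalEquality using (_≡_; refl; sym; trans; cong; subst)
open import Relation.Nullary using (Dec; yes; no; contradiction; ¬?)
open import Relation.Nullary.Decidable using (_×-dec_; _⊎-dec_)

private
  variable
    n : ℕ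
    p q : Subset n
    x : Fin n

countFalse : {A : Set} → (A → Bool) → List A → ℕ
countFalse f []       = zero
countFalse f (a ∷ as) = if f a then countFalse f as else suc (countFalse f as)

module _ {A : Set} {f g : A → Bool} (f≤g : ∀ a → f a ≤ᵇ g a) where

  countFalse-anti : ∀ as → countFalse g as ≤ countFalse f as
  countFalse-anti []       = z≤n
  countFalse-anti (a ∷ as) with f a | g a | f≤g a
  ... | false | false | _ = s≤s (countFalse-anti as)
  ... | false | true  | _ = m≤n⇒m≤1+n (countFalse-anti as)
  ... | true  | true  | _ = countFalse-anti as

  countFalse-anti-< : ∀ {a as} → a ∈ˡ as → f a ≡ false → g a ≡ true →
                      countFalse g as < countFalse f as
  countFalse-anti-< {as = a ∷ as} (here refl) fa ga rewrite fa | ga = s≤s (countFalse-anti as)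
  countFalse-anti-< {as = b ∷ as} (there a∈as) fa ga with f b | g b | f≤g b
  ... | false | false | _ = s≤s (countFalse-anti-< a∈as fa ga)
  ... | false | true  | _ = m≤n⇒m≤1+n (countFalse-anti-< a∈as fa ga)
  ... | true  | true  | _ = countFalse-anti-< a∈as fa ga

insideᵇ : Subset n → Fin n × Fin n → Bool
insideᵇ p (a , b) = lookup p a ∧ lookup p b

-- edgesOutside recurses through a local function that cannot be named here; the
-- meta in the type of `edgesOutside-suffix` is solved from its use in
-- `edgesOutside≡countFalse` as that local function applied to the edge list `w`.
mutual
  edgesOutside≡countFalse : (E : List (Fin n × Fin n)) (S : Subset n) →
                            edgesOutside E S ≡ countFalse (insideᵇ S) E
  edgesOutside≡countFalse []             S = refl
  edgesOutside≡countFalse ((a , b) ∷ es) S with lookup S a ∧ lookup S b | (a , b) ∷ es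
  ... | true  | w = edgesOutside-suffix S w es
  ... | false | w = cong suc (edgesOutside-suffix S w es)

  edgesOutside-suffix : (S : Subset n) (w es : List (Fin n × Fin n)) →
                        _ ≡ countFalse (insideᵇ S) es
  edgesOutside-suffix S w []             = refl
  edgesOutside-suffix S w ((a , b) ∷ es) with lookup S a ∧ lookup S b
  ... | true  = edgesOutside-suffix S w es
  ... | false = cong suc (edgesOutside-suffix S w es)

∧-mono-≤ᵇ : ∀ {a a′ b b′} → a ≤ᵇ a′ → b ≤ᵇ b′ → a ∧ b ≤ᵇ a′ ∧ b′
∧-mono-≤ᵇ f≤t           _   = ≤-minimum _
∧-mono-≤ᵇ {false} b≤b   _   = b≤b
∧-mono-≤ᵇ {true}  b≤b   b≤b′ = b≤b′

lookup-mono : p ⊆ q → ∀ x → lookup p x ≤ᵇ lookup q x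
lookup-mono {p = p} p⊆q x with lookup p x in px
... | false = ≤-minimum _
... | true rewrite []=⇒lookup (p⊆q (lookup⇒[]= x p px)) = b≤b

insideᵇ-mono : p ⊆ q → ∀ e → insideᵇ p e ≤ᵇ insideᵇ q e
insideᵇ-mono p⊆q (a , b) = ∧-mono-≤ᵇ (lookup-mono p⊆q a) (lookup-mono p⊆q b)

∉⇒lookup≡false : x ∉ p → lookup p x ≡ false
∉⇒lookup≡false {x = x} {p = p} x∉p = ¬-not (x∉p ∘ lookup⇒[]= x p)

insideᵇ-true : ∀ {a b} → a ∈ p → b ∈ p → insideᵇ p (a , b) ≡ true
insideᵇ-true a∈p b∈p rewrite []=⇒lookup a∈p | []=⇒lookup b∈p = refl

insideᵇ-falseˡ : ∀ {a b} → a ∉ p → insideᵇ p (a , b) ≡ false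
insideᵇ-falseˡ a∉p rewrite ∉⇒lookup≡false a∉p = refl

insideᵇ-falseʳ : ∀ {a b} → b ∉ p → insideᵇ p (a , b) ≡ false
insideᵇ-falseʳ {p = p} {a} b∉p rewrite ∉⇒lookup≡false b∉p = ∧-zeroʳ (lookup p a)

∣∁p∣≡1+∣∁[p∪⁅x⁆]∣ : (p : Subset n) → x ∉ p → ∣ ∁ p ∣ ≡ suc ∣ ∁ (p ∪ ⁅ x ⁆) ∣
∣∁p∣≡1+∣∁[p∪⁅x⁆]∣ {x = zero}  (false ∷ p) _   = cong (suc ∘ ∣_∣ ∘ ∁) (sym (∪-identityʳ p))
∣∁p∣≡1+∣∁[p∪⁅x⁆]∣ {x = zero}  (true  ∷ p) x∉p = contradiction _[_]=_.here x∉p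
∣∁p∣≡1+∣∁[p∪⁅x⁆]∣ {x = suc x} (false ∷ p) x∉p = cong suc (∣∁p∣≡1+∣∁[p∪⁅x⁆]∣ p (x∉p ∘ _[_]=_.there))
∣∁p∣≡1+∣∁[p∪⁅x⁆]∣ {x = suc x} (true  ∷ p) x∉p = ∣∁p∣≡1+∣∁[p∪⁅x⁆]∣ p (x∉p ∘ _[_]=_.there)

∀∈⇒∣∁p∣≡0 : {p : Subset n} → (∀ x → x ∈ p) → ∣ ∁ p ∣ ≡ 0
∀∈⇒∣∁p∣≡0 {n = n} all∈p =
  trans (cong ∣_∣ (Empty-unique λ (x , x∈∁p) → x∈∁p⇒x∉p x∈∁p (all∈p x))) (∣⊥∣≡0 n)

∣p∣≤∣p∩q∣⇒p⊆q : ∣ p ∣ ≤ ∣ p ∩ q ∣ → p ⊆ q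
∣p∣≤∣p∩q∣⇒p⊆q {p = p} {q = q} ∣p∣≤∣p∩q∣ {x} x∈p with x ∈? q
... | yes x∈q = x∈q
... | no  x∉q = contradiction ∣p∣≤∣p∩q∣ (<⇒≱ (p⊂q⇒∣p∣<∣q∣ p∩q⊂p))
  where
  p∩q⊂p : p ∩ q ⊂ p
  p∩q⊂p = p∩q⊆p p q , x , x∈p , x∉q ∘ proj₂ ∘ x∈p∩q⁻ p q

module _ {n : ℕ} (E : List (Fin n × Fin n)) where

  Closed : Subset n → Set
  Closed T = ∀ {a b} → Adj E a b → a ∈ T → b ∈ T

  Crossing : Subset n → Set
  Crossing T = ∃₂ λ x t → x ∉ T × t ∈ T × Adj E x t

  private
    Leaves : Subset n → Fin n × Fin n → Set
    Leaves T (a , b) = (a ∈ T × b ∉ T) ⊎ (a ∉ T × b ∈ T)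

    leaves? : ∀ T e → Dec (Leaves T e)
    leaves? T (a , b) = ((a ∈? T) ×-dec ¬? (b ∈? T)) ⊎-dec (¬? (a ∈? T) ×-dec (b ∈? T))

  closed⊎crossing : ∀ T → Closed T ⊎ Crossing T
  closed⊎crossing T with any? (leaves? T) E
  ... | yes leaving with find leaving
  ...   | (a , b) , ab∈E , inj₁ (a∈T , b∉T) = inj₂ (b , a , b∉T , a∈T , inj₂ ab∈E)
  ...   | (a , b) , ab∈E , inj₂ (a∉T , b∈T) = inj₂ (a , b , a∉T , b∈T , inj₁ ab∈E)
  closed⊎crossing T | no none-leaves = inj₁ closed
    where
    closed : Closed T
    closed {a} {b} adj a∈T with b ∈? T | adj
    ... | yes b∈T | _         = b∈T
    ... | no  b∉T | inj₁ ab∈E = contradiction (lose ab∈E (inj₁ (a∈T , b∉T))) none-leaves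
    ... | no  b∉T | inj₂ ba∈E = contradiction (lose ba∈E (inj₂ (b∉T , a∈T))) none-leaves

  start∈verts : ∀ {a b} (P : Path E a b) → a ∈ˡ verts E P
  start∈verts (stop a)   = here refl
  start∈verts (step _ _) = here refl

  end∈verts : ∀ {a b} (P : Path E a b) → b ∈ˡ verts E P
  end∈verts (stop a)   = here refl
  end∈verts (step _ P) = there (end∈verts P)

  module _ {T : Subset n} (closed : Closed T) where

    closed-end : ∀ {a b} (P : Path E a b) → a ∈ T → b ∈ T
    closed-end (stop a)     a∈T = a∈T
    closed-end (step adj P) a∈T = closed-end P (closed adj a∈T)

    closed-start : ∀ {a b} (P : Path E a b) → Any (_∈ T) (verts E P) → a ∈ T
    closed-start (stop a)     (here a∈T)     = a∈T
    closed-start (step adj P) (here a∈T)     = a∈T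
    closed-start (step adj P) (there meetsT) = closed (swap adj) (closed-start P meetsT)

    module _ {A B S : Subset n} (S⊆T : S ⊆ T) (blocks : Blocks E A B S) where

      blocks-start∈ : ∀ {a b} → a ∈ A → b ∈ B → Path E a b → a ∈ T
      blocks-start∈ a∈A b∈B P = closed-start P (Any.map S⊆T (blocks _ _ a∈A b∈B P))

      blocks-∩ˡ : Blocks E A B (A ∩ T)
      blocks-∩ˡ a b a∈A b∈B P = lose (start∈verts P) (x∈p∩q⁺ (a∈A , blocks-start∈ a∈A b∈B P))

      blocks-∩ʳ : Blocks E A B (B ∩ T)
      blocks-∩ʳ a b a∈A b∈B P =
        lose (end∈verts P) (x∈p∩q⁺ (b∈B , closed-end P (blocks-start∈ a∈A b∈B P)))

  IsMVS⇒⊆ : ∀ {U V M T} → IsMVS E U V M → IsSeparator E U V (M ∩ T) → M ⊆ T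
  IsMVS⇒⊆ (_ , minimal) sep = ∣p∣≤∣p∩q∣⇒p⊆q (minimal _ sep)

  closed-superset-full : ∀ {U V S T} → IsMVS E U V U → IsMVS E U V V →
                         (∀ x → ∃ λ y → y ∈ (U ∪ V) × Path E x y) →
                         IsSeparator E U V S → Closed T → S ⊆ T → ∀ x → x ∈ T
  closed-superset-full {U} {V} {T = T} U-mvs V-mvs connected sep closed S⊆T x
    with connected x
  ... | y , y∈U∪V , P = closed-start closed P (lose (end∈verts P) y∈T)
    where
    U⊆T : U ⊆ T
    U⊆T = IsMVS⇒⊆ U-mvs (blocks-∩ˡ closed S⊆T sep)
    V⊆T : V ⊆ T
    V⊆T = IsMVS⇒⊆ V-mvs (blocks-∩ʳ closed S⊆T sep)
    y∈T : y ∈ T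
    y∈T = [ U⊆T , V⊆T ] (x∈p∪q⁻ U V y∈U∪V)

  outside : Subset n → ℕ
  outside T = countFalse (insideᵇ T) E

  crossing-decreases-outside : ∀ {T x t} → x ∉ T → t ∈ T → Adj E x t →
                               outside (T ∪ ⁅ x ⁆) < outside T
  crossing-decreases-outside {T} {x} x∉T t∈T adj = shrinks adj
    where
    T⊆T′ : T ⊆ T ∪ ⁅ x ⁆
    T⊆T′ = p⊆p∪q ⁅ x ⁆
    x∈T′ : x ∈ T ∪ ⁅ x ⁆
    x∈T′ = x∈p∪q⁺ (inj₂ (x∈⁅x⁆ x))
    shrinks : Adj E x _ → outside (T ∪ ⁅ x ⁆) < outside T
    shrinks (inj₁ xt∈E) = countFalse-anti-< (insideᵇ-mono T⊆T′) xt∈E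
                            (insideᵇ-falseˡ x∉T) (insideᵇ-true x∈T′ (T⊆T′ t∈T))
    shrinks (inj₂ tx∈E) = countFalse-anti-< (insideᵇ-mono T⊆T′) tx∈E
                            (insideᵇ-falseʳ x∉T) (insideᵇ-true (T⊆T′ t∈T) x∈T′)

  module _ {S : Subset n} (closed-full : ∀ {T} → Closed T → S ⊆ T → ∀ x → x ∈ T) where

    ∣∁∣≤outside : ∀ T → Acc _<_ ∣ ∁ T ∣ → S ⊆ T → ∣ ∁ T ∣ ≤ outside T
    ∣∁∣≤outside T (acc smaller) S⊆T with closed⊎crossing T
    ... | inj₁ closed =
      subst (_≤ outside T) (sym (∀∈⇒∣∁p∣≡0 (closed-full closed S⊆T))) z≤n
    ... | inj₂ (x , t , x∉T , t∈T , adj) = begin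
      ∣ ∁ T ∣                 ≡⟨ shrink ⟩
      suc ∣ ∁ (T ∪ ⁅ x ⁆) ∣   ≤⟨ s≤s (∣∁∣≤outside (T ∪ ⁅ x ⁆) (smaller (≤-reflexive (sym shrink)))
                                                   (p⊆p∪q _ ∘ S⊆T)) ⟩
      suc (outside (T ∪ ⁅ x ⁆)) ≤⟨ crossing-decreases-outside x∉T t∈T adj ⟩
      outside T               ∎
      where
      open ≤-Reasoning
      shrink : ∣ ∁ T ∣ ≡ suc ∣ ∁ (T ∪ ⁅ x ⁆) ∣
      shrink = ∣∁p∣≡1+∣∁[p∪⁅x⁆]∣ T x∉T

mainTheorem9 : (τ : Shape) → IsMiddle τ → AllConnectedToUV τ →
    (S : Subset (Shape.n τ)) → IsSeparator (Shape.edges τ) (Shape.U τ) (Shape.V τ) S →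
    ∣ ∁ S ∣ ≤ edgesOutside (Shape.edges τ) S
mainTheorem9 τ ((U-mvs , _) , (V-mvs , _)) connected S sep =
  subst (∣ ∁ S ∣ ≤_) (sym (edgesOutside≡countFalse edges S))
    (∣∁∣≤outside edges (closed-superset-full edges U-mvs V-mvs connected sep)
      S (<-wellFounded _) ⊆-refl)
  where open Shape τ
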